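{- (i) A permutation $\sigma\in\mathcal{S}_N$ is uniquely determined by the set $\mathcal{M}(\sigma)$ together with the permutation $\mathrm{Patt}(\sigma\setminus\mathcal{M}(\sigma))$. (ii) Let $\hat\tau$ be a pattern with $\hat\tau_1=1$. Then $\sigma$ avoids $1\oslash\hat\tau$ if and only if $\mathrm{Patt}(\sigma\setminus\mathcal{M}(\sigma))$ avoids $\hat\tau$.
   Context: $\mathcal{S}_N$ is the set of permutations of $\{1,\dots,N\}$. For a string $\omega$ of distinct numbers of length $k$, $\mathrm{Patt}(\omega)$ is the unique $\pi\in\mathcal{S}_k$ with $\omega_i<\omega_j\iff\pi_i<\pi_j$. A permutation $\sigma$ contains $\tau\in\mathcal{S}_k$ if some subsequence $\sigma_{i_1}\cdots\sigma_{i_k}$ ($i_1<\dots<i_k$) has $\mathrm{Patt}=\tau$, and avoids $\tau$ otherwise. $\mathcal{M}(\sigma)=\{(i,\sigma_i):\sigma_i<\sigma_t\text{ for every }t<i\}$ is the set of left-to-right minima of the graph of $\sigma$, and $\sigma\setminus\mathcal{M}(\sigma)$ is the string of those $\sigma_t$ (in order of $t$) with $(t,\sigma_t)\notin\mathcal{M}(\sigma)$. For $\omega\in\mathcal{S}_m$, $1\oslash\omega=1(\omega_1+1)\cdots(\omega_m+1)\in\mathcal{S}_{m+1}$. -}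

module Defs where

open import Data.Nat using (ℕ; zero; suc; _<_; _<?_)
open import Data.Nat.Properties using ()
open import Data.Fin using (Fin; toℕ)
import Data.Fin as F
open import Data.Fin.Properties using (all?)
open import Data.List using (List; []; _∷_; map; filter; length; lookup; allFin; upTo)
open import Data.List.Relation.Binary.Permutation.Propositional using (_↭_)
open import Data.List.Relation.Binary.Sublist.Propositional using (_⊆_)
open import Data.Product using (_×_; _,_; ∃-syntax)
open import Relation.Nullary using (Dec; ¬_)
open import Relation.Binary.PropositionalEquality using (_≡_)
open import Relation.Nullary.Decidable using (_→-dec_; ¬?)

IsPerm : ℕ → List ℕ → Set
IsPerm N σ = σ ↭ map suc (upTo N)

Patt : List ℕ → List ℕ
Patt ω = map (λ x → suc (length (filter (λ y → y <? x) ω))) ω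

Contains : List ℕ → List ℕ → Set
Contains σ τ = ∃[ ω ] (ω ⊆ σ × Patt ω ≡ τ)

Avoids : List ℕ → List ℕ → Set
Avoids σ τ = ¬ Contains σ τ

IsLRMin : (σ : List ℕ) → Fin (length σ) → Set
IsLRMin σ p = (t : Fin (length σ)) → t F.< p → lookup σ p < lookup σ t

isLRMin? : (σ : List ℕ) → (p : Fin (length σ)) → Dec (IsLRMin σ p)
isLRMin? σ p = all? (λ t → (t F.<? p) →-dec (lookup σ p <? lookup σ t))

M : List ℕ → List (ℕ × ℕ)
M σ = map (λ p → (suc (toℕ p) , lookup σ p)) (filter (isLRMin? σ) (allFin (length σ)))

_∖M : List ℕ → List ℕ
σ ∖M = map (lookup σ) (filter (λ p → ¬? (isLRMin? σ p)) (allFin (length σ)))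

1⊘_ : List ℕ → List ℕ
1⊘ ω = 1 ∷ map suc ω

module Submission where

-- Read σ from left to right, keeping track of the running minimum m: an entry is a left-to-right
-- minimum exactly when it is below m. This reading can be undone from the minima (with their
-- positions) and the remaining entries in order. Since σ is a permutation of 1, …, N, the remaining
-- entries are known as a multiset once 𝓜(σ) is, so their pattern pins down their order.
-- For (ii), in an occurrence z ω of 1 ⊘ τ̂ every entry of ω lies after and above z, so ω avoids 𝓜(σ).
-- Conversely, as τ̂ starts with 1, the first entry w of an occurrence of τ̂ among the non-minima is
-- its smallest one, and an earlier entry below w (there is one, as w is not a left-to-right minimum)
-- extends it to an occurrence of 1 ⊘ τ̂. Finally, replacing a list by its pattern does not change
-- the patterns of its subsequences.

open import Defs
open import Level using (0ℓ)
open import Data.Nat using (ℕ; zero; suc; _<_; _≤_; _<?_; _+_; z≤n; s≤s)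
open import Data.Nat.Properties
open import Data.Fin using (Fin; toℕ)
import Data.Fin as F
open import Data.Maybe using (just)
open import Data.Product using (_×_; _,_; ∃-syntax; proj₁; proj₂; uncurry)
open import Data.List using (List; []; _∷_; _++_; map; filter; length; head; lookup; tabulate; allFin)
open import Data.List.Properties
  using (map-tabulate; map-cong; map-cong-local; map-∘; map-injective; ∷-injective; filter-accept; filter-reject; filter-none)
open import Data.List.Membership.Propositional using (_∈_; _∉_)
open import Data.List.Relation.Unary.Any using (here; there)
open import Data.List.Relation.Unary.All as All using (All; []; _∷_)
open import Data.List.Relation.Unary.AllPairs using (AllPairs; []; _∷_)
open import Data.List.Relation.Unary.Unique.Propositional using (Unique)
open import Data.List.Relation.Unary.Unique.Propositional.Properties using (upTo⁺) renaming (map⁺ to map⁺-Unique)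
open import Data.List.Relation.Binary.Permutation.Propositional
  using (_↭_; ↭-refl; ↭-sym; ↭-trans; prep; ↭⇒↭ₛ; module PermutationReasoning)
open import Data.List.Relation.Binary.Permutation.Propositional.Properties using (filter-↭; ↭-length; ∈-resp-↭; drop-∷; shift)
open import Data.List.Relation.Binary.Sublist.Propositional using (_⊆_; []; _∷_; _∷ʳ_)
import Data.List.Relation.Binary.Sublist.Propositional as Sublist
open import Data.List.Relation.Binary.Sublist.Propositional.Properties using (filter⁺; length-mono-≤; map⁺; All-resp-⊆)
open import Function using (_∘_; id)
open import Function.Bundles using (_⇔_; mk⇔; Equivalence)
import Function.Properties.Equivalence as ⇔
open import Function.Related.TypeIsomorphisms using (¬-cong-⇔)
open import Relation.Nullary using (yes; no; ¬_; contradiction)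
open import Relation.Nullary.Decidable using (_×-dec_; ¬?)
open import Relation.Unary using (Pred; Decidable)
open import Relation.Binary.Definitions using (Asymmetric; tri<; tri≈; tri>)
open import Relation.Binary.PropositionalEquality as ≡ using (_≡_; refl; sym; trans; cong; cong₂; subst; subst₂)
open import Data.List.Relation.Binary.Permutation.Setoid.Properties (≡.setoid ℕ) using (Unique-resp-↭)

countBelow : ℕ → List ℕ → ℕ
countBelow x L = length (filter (_<? x) L)

-- Patt L unfolds to map (rank L) L.
rank : List ℕ → ℕ → ℕ
rank L x = suc (countBelow x L)

countBelow-accept : ∀ {x y} L → y < x → countBelow x (y ∷ L) ≡ suc (countBelow x L)
countBelow-accept L y<x = cong length (filter-accept (_<? _) y<x)

countBelow-reject : ∀ {x y} L → ¬ y < x → countBelow x (y ∷ L) ≡ countBelow x L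
countBelow-reject L y≮x = cong length (filter-reject (_<? _) y≮x)

countBelow-mono : ∀ {x y L L′} → x ≤ y → L ⊆ L′ → countBelow x L ≤ countBelow y L′
countBelow-mono x≤y L⊆L′ = length-mono-≤ (filter⁺ (_<? _) (_<? _) (λ { refl z<x → <-≤-trans z<x x≤y }) L⊆L′)

countBelow-strict : ∀ {x y L} → x ∈ L → x < y → countBelow x L < countBelow y L
countBelow-strict {x} {y} {x ∷ L} (here refl) x<y = begin-strict
  countBelow x (x ∷ L)   ≡⟨ countBelow-reject L (<-irrefl refl) ⟩
  countBelow x L         <⟨ s≤s (countBelow-mono (<⇒≤ x<y) (Sublist.⊆-refl {x = L})) ⟩
  suc (countBelow y L)   ≡⟨ countBelow-accept L x<y ⟨
  countBelow y (x ∷ L)   ∎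
  where open ≤-Reasoning
countBelow-strict {x} {y} {a ∷ L} (there x∈L) x<y with a <? x
... | yes a<x = begin-strict
  countBelow x (a ∷ L)   ≡⟨ countBelow-accept L a<x ⟩
  suc (countBelow x L)   <⟨ s≤s (countBelow-strict x∈L x<y) ⟩
  suc (countBelow y L)   ≡⟨ countBelow-accept L (<-trans a<x x<y) ⟨
  countBelow y (a ∷ L)   ∎
  where open ≤-Reasoning
... | no a≮x = begin-strict
  countBelow x (a ∷ L)   ≡⟨ countBelow-reject L a≮x ⟩
  countBelow x L         <⟨ countBelow-strict x∈L x<y ⟩
  countBelow y L         ≤⟨ countBelow-mono ≤-refl (a ∷ʳ Sublist.⊆-refl {x = L}) ⟩
  countBelow y (a ∷ L)   ∎
  where open ≤-Reasoning

countBelow-↭ : ∀ {L L′} x → L ↭ L′ → countBelow x L ≡ countBelow x L′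
countBelow-↭ x L↭L′ = ↭-length (filter-↭ (_<? x) L↭L′)

countBelow-≡0 : ∀ {x} L → countBelow x L ≡ 0 → All (x ≤_) L
countBelow-≡0 [] _ = []
countBelow-≡0 {x} (y ∷ L) eq with y <? x
... | yes y<x = contradiction (trans (sym (countBelow-accept L y<x)) eq) λ ()
... | no y≮x = ≮⇒≥ y≮x ∷ countBelow-≡0 L (trans (sym (countBelow-reject L y≮x)) eq)

countBelow-minimum : ∀ {x L} → All (x <_) L → countBelow x L ≡ 0
countBelow-minimum x<L = cong length (filter-none (_<? _) (All.map <⇒≯ x<L))

StrictlyMonotoneOn : List ℕ → (ℕ → ℕ) → Set
StrictlyMonotoneOn L f = ∀ {x y} → x ∈ L → y ∈ L → x < y → f x < f y

module _ {L : List ℕ} {f : ℕ → ℕ} (mono : StrictlyMonotoneOn L f) where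

  strictlyMonotoneOn-reflects : ∀ {x y} → x ∈ L → y ∈ L → f x < f y → x < y
  strictlyMonotoneOn-reflects {x} {y} x∈L y∈L fx<fy with <-cmp x y
  ... | tri< x<y _ _ = x<y
  ... | tri≈ _ refl _ = contradiction fx<fy (<-irrefl refl)
  ... | tri> _ _ y<x = contradiction fx<fy (<-asym (mono y∈L x∈L y<x))

  strictlyMonotoneOn-injective : ∀ {x y} → x ∈ L → y ∈ L → f x ≡ f y → x ≡ y
  strictlyMonotoneOn-injective {x} {y} x∈L y∈L fx≡fy with <-cmp x y
  ... | tri< x<y _ _ = contradiction fx≡fy (<⇒≢ (mono x∈L y∈L x<y))
  ... | tri≈ _ x≡y _ = x≡y
  ... | tri> _ _ y<x = contradiction (sym fx≡fy) (<⇒≢ (mono y∈L x∈L y<x))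

  countBelow-map : ∀ {x l} → All (_∈ L) l → x ∈ L → countBelow (f x) (map f l) ≡ countBelow x l
  countBelow-map {x} {[]} [] x∈L = refl
  countBelow-map {x} {a ∷ l} (a∈L ∷ l⊆L) x∈L with a <? x
  ... | yes a<x = begin
    countBelow (f x) (f a ∷ map f l)  ≡⟨ countBelow-accept (map f l) (mono a∈L x∈L a<x) ⟩
    suc (countBelow (f x) (map f l))  ≡⟨ cong suc (countBelow-map l⊆L x∈L) ⟩
    suc (countBelow x l)              ≡⟨ countBelow-accept l a<x ⟨
    countBelow x (a ∷ l)              ∎
    where open ≡.≡-Reasoning
  ... | no a≮x = begin
    countBelow (f x) (f a ∷ map f l)  ≡⟨ countBelow-reject (map f l) (a≮x ∘ strictlyMonotoneOn-reflects a∈L x∈L) ⟩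
    countBelow (f x) (map f l)        ≡⟨ countBelow-map l⊆L x∈L ⟩
    countBelow x l                    ≡⟨ countBelow-reject l a≮x ⟨
    countBelow x (a ∷ l)              ∎
    where open ≡.≡-Reasoning

rank-strictlyMonotoneOn : ∀ L → StrictlyMonotoneOn L (rank L)
rank-strictlyMonotoneOn L x∈L _ x<y = s≤s (countBelow-strict x∈L x<y)

Patt-map : ∀ {f ws} → StrictlyMonotoneOn ws f → Patt (map f ws) ≡ Patt ws
Patt-map {f} {ws} mono = begin
  map (rank (map f ws)) (map f ws)  ≡⟨ map-∘ ws ⟨
  map (rank (map f ws) ∘ f) ws      ≡⟨ map-cong-local (All.tabulate (cong suc ∘ countBelow-map mono (All.tabulate id))) ⟩
  map (rank ws) ws                  ∎
  where open ≡.≡-Reasoning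

map-injectiveOn : ∀ {A B : Set} {S : List A} {f : A → B} {xs ys} →
  (∀ {x y} → x ∈ S → y ∈ S → f x ≡ f y → x ≡ y) →
  All (_∈ S) xs → All (_∈ S) ys → map f xs ≡ map f ys → xs ≡ ys
map-injectiveOn inj [] [] _ = refl
map-injectiveOn inj (x∈S ∷ xs⊆S) (y∈S ∷ ys⊆S) eq =
  cong₂ _∷_ (inj x∈S y∈S (proj₁ (∷-injective eq))) (map-injectiveOn inj xs⊆S ys⊆S (proj₂ (∷-injective eq)))

Patt-↭-injective : ∀ {L L′} → L ↭ L′ → Patt L ≡ Patt L′ → L ≡ L′
Patt-↭-injective {L} {L′} L↭L′ eq =
  map-injectiveOn (strictlyMonotoneOn-injective (rank-strictlyMonotoneOn L′))
    (All.tabulate (∈-resp-↭ L↭L′)) (All.tabulate id)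
    (trans (sym (map-cong (λ x → cong suc (countBelow-↭ x L↭L′)) L)) eq)

Patt-∷-minimum : ∀ {z l} → All (z <_) l → Patt (z ∷ l) ≡ 1⊘ Patt l
Patt-∷-minimum {z} {l} z<l = cong₂ _∷_
  (cong suc (trans (countBelow-reject l (<-irrefl refl)) (countBelow-minimum z<l)))
  (trans (map-cong-local (All.map (cong suc ∘ countBelow-accept l) z<l)) (map-∘ l))

Patt-∷-head : ∀ {z l t} → Patt (z ∷ l) ≡ 1 ∷ t → All (z ≤_) l
Patt-∷-head {z} {l} eq = All.tail (countBelow-≡0 (z ∷ l) (suc-injective (proj₁ (∷-injective eq))))

strictlyMonotoneOn-⊆ : ∀ {ws L f} → ws ⊆ L → StrictlyMonotoneOn L f → StrictlyMonotoneOn ws f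
strictlyMonotoneOn-⊆ ws⊆L mono x∈ws y∈ws = mono (Sublist.lookup ws⊆L x∈ws) (Sublist.lookup ws⊆L y∈ws)

⊆-map⁻ : ∀ {A B : Set} (g : A → B) {ω} L → ω ⊆ map g L → ∃[ ws ] (ws ⊆ L × ω ≡ map g ws)
⊆-map⁻ g [] [] = [] , [] , refl
⊆-map⁻ g (a ∷ L) (_ ∷ʳ ω⊆) with ⊆-map⁻ g L ω⊆
... | ws , ws⊆L , refl = ws , a ∷ʳ ws⊆L , refl
⊆-map⁻ g (a ∷ L) (refl ∷ ω⊆) with ⊆-map⁻ g L ω⊆
... | ws , ws⊆L , refl = a ∷ ws , refl ∷ ws⊆L , refl

Contains-Patt : ∀ L τ → Contains (Patt L) τ ⇔ Contains L τ
Contains-Patt L τ = mk⇔ to from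
  where
  pattern-preserved : ∀ {ws} → ws ⊆ L → Patt (map (rank L) ws) ≡ Patt ws
  pattern-preserved ws⊆L = Patt-map (strictlyMonotoneOn-⊆ ws⊆L (rank-strictlyMonotoneOn L))

  to : Contains (Patt L) τ → Contains L τ
  to (ω , ω⊆ , refl) with ⊆-map⁻ (rank L) L ω⊆
  ... | ws , ws⊆L , refl = ws , ws⊆L , sym (pattern-preserved ws⊆L)

  from : Contains L τ → Contains (Patt L) τ
  from (ws , ws⊆L , refl) = map (rank L) ws , map⁺ (rank L) ws⊆L , pattern-preserved ws⊆L

AllPairs-resp-⊇ : ∀ {A : Set} {R : A → A → Set} {xs ys} → xs ⊆ ys → AllPairs R ys → AllPairs R xs
AllPairs-resp-⊇ [] ys = ys
AllPairs-resp-⊇ (_ ∷ʳ xs⊆ys) (_ ∷ ys) = AllPairs-resp-⊇ xs⊆ys ys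
AllPairs-resp-⊇ (refl ∷ xs⊆ys) (y ∷ ys) = All-resp-⊆ xs⊆ys y ∷ AllPairs-resp-⊇ xs⊆ys ys

-- minima i m xs lists the left-to-right minima of xs that are smaller than m (the minimum of the
-- entries read before xs), paired with their positions counted from i; nonMinima m xs lists the rest.
minima : ℕ → ℕ → List ℕ → List (ℕ × ℕ)
minima i m [] = []
minima i m (x ∷ xs) with x <? m
... | yes _ = (i , x) ∷ minima (suc i) x xs
... | no _ = minima (suc i) m xs

nonMinima : ℕ → List ℕ → List ℕ
nonMinima m [] = []
nonMinima m (x ∷ xs) with x <? m
... | yes _ = nonMinima x xs
... | no _ = x ∷ nonMinima m xs

minima₀ : List ℕ → List (ℕ × ℕ)
minima₀ [] = []
minima₀ (x ∷ xs) = (1 , x) ∷ minima 2 x xs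

nonMinima₀ : List ℕ → List ℕ
nonMinima₀ [] = []
nonMinima₀ (x ∷ xs) = nonMinima x xs

nonMinima-⊆ : ∀ m xs → nonMinima m xs ⊆ xs
nonMinima-⊆ m [] = []
nonMinima-⊆ m (x ∷ xs) with x <? m
... | yes _ = x ∷ʳ nonMinima-⊆ x xs
... | no _ = refl ∷ nonMinima-⊆ m xs

⊆-nonMinima-above : ∀ {m ws} xs → All (m <_) ws → ws ⊆ xs → ws ⊆ nonMinima m xs
⊆-nonMinima-above [] _ [] = []
⊆-nonMinima-above {m} (y ∷ ys) m<ws ws⊆ with y <? m
⊆-nonMinima-above (y ∷ ys) (m<y ∷ _) (refl ∷ _) | yes y<m = contradiction y<m (<-asym m<y)
⊆-nonMinima-above (y ∷ ys) m<ws (_ ∷ʳ ws⊆) | yes y<m = ⊆-nonMinima-above ys (All.map (<-trans y<m) m<ws) ws⊆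
⊆-nonMinima-above (y ∷ ys) (_ ∷ m<ws) (refl ∷ ws⊆) | no _ = refl ∷ ⊆-nonMinima-above ys m<ws ws⊆
⊆-nonMinima-above (y ∷ ys) m<ws (_ ∷ʳ ws⊆) | no _ = y ∷ʳ ⊆-nonMinima-above ys m<ws ws⊆

⊆-nonMinima-after : ∀ {m z ws} xs → All (z <_) ws → z ∷ ws ⊆ m ∷ xs → ws ⊆ nonMinima m xs
⊆-nonMinima-after xs z<ws (refl ∷ ws⊆) = ⊆-nonMinima-above xs z<ws ws⊆
⊆-nonMinima-after {m} (y ∷ ys) z<ws (_ ∷ʳ z∷ws⊆) with y <? m
... | yes _ = ⊆-nonMinima-after ys z<ws z∷ws⊆
⊆-nonMinima-after (y ∷ ys) z<ws (_ ∷ʳ (refl ∷ ws⊆)) | no y≮m =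
  y ∷ʳ ⊆-nonMinima-above ys (All.map (≤-<-trans (≮⇒≥ y≮m)) z<ws) ws⊆
⊆-nonMinima-after {m} (y ∷ ys) z<ws (_ ∷ʳ (_ ∷ʳ z∷ws⊆)) | no _ =
  y ∷ʳ ⊆-nonMinima-after ys z<ws (m ∷ʳ z∷ws⊆)

nonMinima-predecessor : ∀ {m w ws} xs → Unique (m ∷ xs) → w ∷ ws ⊆ nonMinima m xs →
  ∃[ z ] (z < w × z ∷ w ∷ ws ⊆ m ∷ xs)
nonMinima-predecessor {m} (y ∷ ys) uniq w∷ws⊆ with y <? m
nonMinima-predecessor {m} (y ∷ ys) (_ ∷ uniq) w∷ws⊆ | yes _ with nonMinima-predecessor ys uniq w∷ws⊆
... | z , z<w , z∷w∷ws⊆ = z , z<w , m ∷ʳ z∷w∷ws⊆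
nonMinima-predecessor {m} (y ∷ ys) ((m≢y ∷ m≢ys) ∷ (_ ∷ uniq)) (refl ∷ ws⊆) | no y≮m =
  m , ≤∧≢⇒< (≮⇒≥ y≮m) m≢y , refl ∷ refl ∷ Sublist.⊆-trans ws⊆ (nonMinima-⊆ m ys)
nonMinima-predecessor {m} (y ∷ ys) ((_ ∷ m≢ys) ∷ (_ ∷ uniq)) (_ ∷ʳ w∷ws⊆) | no _
  with nonMinima-predecessor ys (m≢ys ∷ uniq) w∷ws⊆
... | z , z<w , z∷w∷ws⊆ = z , z<w , Sublist.⊆-trans z∷w∷ws⊆ (refl ∷ (y ∷ʳ Sublist.⊆-refl))

1⊘-injective : ∀ {ω ω′} → 1⊘ ω ≡ 1⊘ ω′ → ω ≡ ω′
1⊘-injective = map-injective suc-injective ∘ proj₂ ∘ ∷-injective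

⊆-nonMinima₀ : ∀ {z ws} σ → All (z <_) ws → z ∷ ws ⊆ σ → ws ⊆ nonMinima₀ σ
⊆-nonMinima₀ (x ∷ xs) = ⊆-nonMinima-after xs

nonMinima₀-predecessor : ∀ {w ws} σ → Unique σ → w ∷ ws ⊆ nonMinima₀ σ → ∃[ z ] (z < w × z ∷ w ∷ ws ⊆ σ)
nonMinima₀-predecessor (x ∷ xs) = nonMinima-predecessor xs

Contains-1⊘⇔Contains-nonMinima₀ : ∀ σ t → Unique σ → Contains σ (1⊘ (1 ∷ t)) ⇔ Contains (nonMinima₀ σ) (1 ∷ t)
Contains-1⊘⇔Contains-nonMinima₀ σ t uniq = mk⇔ to from
  where
  to : Contains σ (1⊘ (1 ∷ t)) → Contains (nonMinima₀ σ) (1 ∷ t)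
  to (z ∷ ws , z∷ws⊆σ , patt) = ws , ⊆-nonMinima₀ σ z<ws z∷ws⊆σ , 1⊘-injective (trans (sym (Patt-∷-minimum z<ws)) patt)
    where
    z<ws : All (z <_) ws
    z<ws with z≢ws ∷ _ ← AllPairs-resp-⊇ z∷ws⊆σ uniq = All.zipWith (uncurry ≤∧≢⇒<) (Patt-∷-head patt , z≢ws)

  from : Contains (nonMinima₀ σ) (1 ∷ t) → Contains σ (1⊘ (1 ∷ t))
  from (w ∷ ws , w∷ws⊆ , patt) with z , z<w , z∷w∷ws⊆σ ← nonMinima₀-predecessor σ uniq w∷ws⊆ =
    z ∷ w ∷ ws , z∷w∷ws⊆σ , trans (Patt-∷-minimum (z<w ∷ All.map (<-≤-trans z<w) (Patt-∷-head patt))) (cong 1⊘_ patt)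

PositionsIncreasing : List (ℕ × ℕ) → Set
PositionsIncreasing = AllPairs (λ p q → proj₁ p < proj₁ q)

minima-positions-≥ : ∀ i m xs → All (λ p → i ≤ proj₁ p) (minima i m xs)
minima-positions-≥ i m [] = []
minima-positions-≥ i m (x ∷ xs) with x <? m
... | yes _ = ≤-refl ∷ All.map (≤-trans (n≤1+n i)) (minima-positions-≥ (suc i) x xs)
... | no _ = All.map (≤-trans (n≤1+n i)) (minima-positions-≥ (suc i) m xs)

minima-earlier-∉ : ∀ i m xs {v} → (i , v) ∉ minima (suc i) m xs
minima-earlier-∉ i m xs i∈ = <-irrefl refl (All.lookup (minima-positions-≥ (suc i) m xs) i∈)

minima-positionsIncreasing : ∀ i m xs → PositionsIncreasing (minima i m xs)
minima-positionsIncreasing i m [] = []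
minima-positionsIncreasing i m (x ∷ xs) with x <? m
... | yes _ = minima-positions-≥ (suc i) x xs ∷ minima-positionsIncreasing (suc i) x xs
... | no _ = minima-positionsIncreasing (suc i) m xs

minima₀-positionsIncreasing : ∀ σ → PositionsIncreasing (minima₀ σ)
minima₀-positionsIncreasing [] = []
minima₀-positionsIncreasing (x ∷ xs) = minima-positions-≥ 2 x xs ∷ minima-positionsIncreasing 2 x xs

sorted-sameMembers⇒≡ : ∀ {A : Set} {_≺_ : A → A → Set} → Asymmetric _≺_ → ∀ {xs ys} →
  AllPairs _≺_ xs → AllPairs _≺_ ys → (∀ x → x ∈ xs ⇔ x ∈ ys) → xs ≡ ys
sorted-sameMembers⇒≡ asym [] [] _ = refl
sorted-sameMembers⇒≡ asym [] (_∷_ {y} _ _) same with () ← Equivalence.from (same y) (here refl)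
sorted-sameMembers⇒≡ asym (_∷_ {x} _ _) [] same with () ← Equivalence.to (same x) (here refl)
sorted-sameMembers⇒≡ {_≺_ = _≺_} asym (_∷_ {x} {xs} x≺xs sxs) (_∷_ {y} {ys} y≺ys sys) same =
  cong₂ _∷_ x≡y (sorted-sameMembers⇒≡ asym sxs sys (sameTails x≡y))
  where
  x≡y : x ≡ y
  x≡y with Equivalence.to (same x) (here refl) | Equivalence.from (same y) (here refl)
  ... | here x≡y | _ = x≡y
  ... | there _ | here y≡x = sym y≡x
  ... | there x∈ys | there y∈xs = contradiction (All.lookup x≺xs y∈xs) (asym (All.lookup y≺ys x∈ys))

  dropHead : ∀ {a z ws vs} → All (a ≺_) ws → (z ∈ a ∷ ws → z ∈ a ∷ vs) → z ∈ ws → z ∈ vs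
  dropHead a≺ws f z∈ws with f (there z∈ws)
  ... | here refl = contradiction (All.lookup a≺ws z∈ws) (λ a≺a → asym a≺a a≺a)
  ... | there z∈vs = z∈vs

  sameTails : x ≡ y → ∀ z → z ∈ xs ⇔ z ∈ ys
  sameTails refl z = mk⇔ (dropHead x≺xs (Equivalence.to (same z))) (dropHead y≺ys (Equivalence.from (same z)))

minima-↭ : ∀ i m xs → xs ↭ map proj₂ (minima i m xs) ++ nonMinima m xs
minima-↭ i m [] = ↭-refl
minima-↭ i m (x ∷ xs) with x <? m
... | yes _ = prep x (minima-↭ (suc i) x xs)
... | no _ = ↭-trans (prep x (minima-↭ (suc i) m xs))
                     (↭-sym (shift x (map proj₂ (minima (suc i) m xs)) (nonMinima m xs)))

++-cancelˡ-↭ : ∀ {A : Set} (as : List A) {bs cs} → as ++ bs ↭ as ++ cs → bs ↭ cs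
++-cancelˡ-↭ [] bs↭cs = bs↭cs
++-cancelˡ-↭ (a ∷ as) a∷as++bs↭a∷as++cs = ++-cancelˡ-↭ as (drop-∷ a∷as++bs↭a∷as++cs)

minima-nonMinima-injective : ∀ i m xs ys → minima i m xs ≡ minima i m ys → nonMinima m xs ≡ nonMinima m ys → xs ≡ ys
minima-nonMinima-injective i m [] [] _ _ = refl
minima-nonMinima-injective i m [] (y ∷ ys) eqᵐ eqⁿ with y <? m
minima-nonMinima-injective i m [] (y ∷ ys) () eqⁿ | yes _
minima-nonMinima-injective i m [] (y ∷ ys) eqᵐ () | no _
minima-nonMinima-injective i m (x ∷ xs) [] eqᵐ eqⁿ with x <? m
minima-nonMinima-injective i m (x ∷ xs) [] () eqⁿ | yes _
minima-nonMinima-injective i m (x ∷ xs) [] eqᵐ () | no _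
minima-nonMinima-injective i m (x ∷ xs) (y ∷ ys) eqᵐ eqⁿ with x <? m | y <? m
... | yes _ | yes _ with refl , eqᵐ′ ← ∷-injective eqᵐ =
  cong (x ∷_) (minima-nonMinima-injective (suc i) x xs ys eqᵐ′ eqⁿ)
... | no _ | no _ with refl , eqⁿ′ ← ∷-injective eqⁿ =
  cong (x ∷_) (minima-nonMinima-injective (suc i) m xs ys eqᵐ eqⁿ′)
... | yes _ | no _ = contradiction (subst ((i , x) ∈_) eqᵐ (here refl)) (minima-earlier-∉ i m ys)
... | no _ | yes _ = contradiction (subst ((i , y) ∈_) (sym eqᵐ) (here refl)) (minima-earlier-∉ i m xs)

determined-by-minima₀ : ∀ {σ σ′} → σ ↭ σ′ → minima₀ σ ≡ minima₀ σ′ →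
  Patt (nonMinima₀ σ) ≡ Patt (nonMinima₀ σ′) → σ ≡ σ′
determined-by-minima₀ {[]} {[]} _ _ _ = refl
determined-by-minima₀ {x ∷ xs} {y ∷ ys} σ↭σ′ eqᵐ samePatt with refl , sameMinima ← ∷-injective eqᵐ =
  cong (x ∷_) (minima-nonMinima-injective 2 x xs ys sameMinima (Patt-↭-injective nonMinima-↭ samePatt))
  where
  values = map proj₂ (minima 2 x xs)
  nonMinima-↭ : nonMinima x xs ↭ nonMinima x ys
  nonMinima-↭ = ++-cancelˡ-↭ values (begin
    values ++ nonMinima x xs                    ↭⟨ minima-↭ 2 x xs ⟨
    xs                                          ↭⟨ drop-∷ σ↭σ′ ⟩
    ys                                          ↭⟨ minima-↭ 2 x ys ⟩
    map proj₂ (minima 2 x ys) ++ nonMinima x ys ≡⟨ cong (λ ms → map proj₂ ms ++ nonMinima x ys) sameMinima ⟨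
    values ++ nonMinima x ys                    ∎)
    where open PermutationReasoning

map-filter-map : ∀ {A B C : Set} {P : Pred B 0ℓ} {Q : Pred A 0ℓ} (P? : Decidable P) (Q? : Decidable Q)
  (f : A → B) (h : B → C) → (∀ a → P (f a) ⇔ Q a) →
  ∀ as → map h (filter P? (map f as)) ≡ map (h ∘ f) (filter Q? as)
map-filter-map P? Q? f h P⇔Q [] = refl
map-filter-map P? Q? f h P⇔Q (a ∷ as) with P? (f a) | Q? a
... | yes _ | yes _ = cong (h (f a) ∷_) (map-filter-map P? Q? f h P⇔Q as)
... | no _ | no _ = map-filter-map P? Q? f h P⇔Q as
... | yes Pfa | no ¬Qa = contradiction (Equivalence.to (P⇔Q a) Pfa) ¬Qa
... | no ¬Pfa | yes Qa = contradiction (Equivalence.from (P⇔Q a) Qa) ¬Pfa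

module _ {B : Set} {n} {P : Pred (Fin (suc n)) 0ℓ} {Q : Pred (Fin n) 0ℓ} (P? : Decidable P) (Q? : Decidable Q)
         (P⇔Q : ∀ p → P (F.suc p) ⇔ Q p) (h : Fin (suc n) → B) where

  private
    map-filter-tabulate-suc : map h (filter P? (tabulate F.suc)) ≡ map (h ∘ F.suc) (filter Q? (allFin n))
    map-filter-tabulate-suc =
      trans (cong (map h ∘ filter P?) (sym (map-tabulate id F.suc))) (map-filter-map P? Q? F.suc h P⇔Q (allFin n))

  map-filter-allFin-accept : P F.zero →
    map h (filter P? (allFin (suc n))) ≡ h F.zero ∷ map (h ∘ F.suc) (filter Q? (allFin n))
  map-filter-allFin-accept P0 = trans (cong (map h) (filter-accept P? P0)) (cong (h F.zero ∷_) map-filter-tabulate-suc)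

  map-filter-allFin-reject : ¬ P F.zero →
    map h (filter P? (allFin (suc n))) ≡ map (h ∘ F.suc) (filter Q? (allFin n))
  map-filter-allFin-reject ¬P0 = trans (cong (map h) (filter-reject P? ¬P0)) map-filter-tabulate-suc

IsLRMinBelow : ℕ → (xs : List ℕ) → Fin (length xs) → Set
IsLRMinBelow m xs p = lookup xs p < m × IsLRMin xs p

isLRMinBelow? : ∀ m xs → Decidable (IsLRMinBelow m xs)
isLRMinBelow? m xs p = (lookup xs p <? m) ×-dec isLRMin? xs p

isLRMin-zero : ∀ y ys → IsLRMin (y ∷ ys) F.zero
isLRMin-zero y ys t ()

isLRMin-suc : ∀ y ys p → IsLRMin (y ∷ ys) (F.suc p) ⇔ IsLRMinBelow y ys p
isLRMin-suc y ys p = mk⇔ (λ min → min F.zero (s≤s z≤n) , λ t t<p → min (F.suc t) (s≤s t<p)) from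
  where
  from : IsLRMinBelow y ys p → IsLRMin (y ∷ ys) (F.suc p)
  from (p<y , _) F.zero _ = p<y
  from (_ , min) (F.suc t) (s≤s t<p) = min t t<p

isLRMinBelow-suc-< : ∀ {m y} ys p → y < m → IsLRMinBelow m (y ∷ ys) (F.suc p) ⇔ IsLRMinBelow y ys p
isLRMinBelow-suc-< {y = y} ys p y<m = mk⇔ (Equivalence.to (isLRMin-suc y ys p) ∘ proj₂)
  (λ below → <-trans (proj₁ below) y<m , Equivalence.from (isLRMin-suc y ys p) below)

isLRMinBelow-suc-≮ : ∀ {m y} ys p → ¬ y < m → IsLRMinBelow m (y ∷ ys) (F.suc p) ⇔ IsLRMinBelow m ys p
isLRMinBelow-suc-≮ {y = y} ys p y≮m = mk⇔ (λ (p<m , min) → p<m , proj₂ (Equivalence.to (isLRMin-suc y ys p) min))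
  (λ (p<m , min) → p<m , Equivalence.from (isLRMin-suc y ys p) (<-≤-trans p<m (≮⇒≥ y≮m) , min))

shift-position : ∀ {i y} (ys : List ℕ) (p : Fin (length ys)) →
  (i + toℕ (F.suc p) , lookup (y ∷ ys) (F.suc p)) ≡ (suc i + toℕ p , lookup ys p)
shift-position {i} ys p = cong (_, lookup ys p) (+-suc i (toℕ p))

minima-spec : ∀ i m xs →
  map (λ p → (i + toℕ p , lookup xs p)) (filter (isLRMinBelow? m xs) (allFin (length xs))) ≡ minima i m xs
minima-spec i m [] = refl
minima-spec i m (y ∷ ys) with y <? m
... | yes y<m = begin
  map h (filter (isLRMinBelow? m (y ∷ ys)) (allFin (suc (length ys))))
    ≡⟨ map-filter-allFin-accept (isLRMinBelow? m (y ∷ ys)) (isLRMinBelow? y ys) (λ p → isLRMinBelow-suc-< ys p y<m) h (y<m , isLRMin-zero y ys) ⟩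
  h F.zero ∷ map (h ∘ F.suc) (filter (isLRMinBelow? y ys) (allFin (length ys)))
    ≡⟨ cong₂ _∷_ (cong (_, y) (+-identityʳ i)) (trans (map-cong (shift-position {i} {y} ys) _) (minima-spec (suc i) y ys)) ⟩
  (i , y) ∷ minima (suc i) y ys ∎
  where
  h : Fin (length (y ∷ ys)) → ℕ × ℕ
  h p = (i + toℕ p , lookup (y ∷ ys) p)
  open ≡.≡-Reasoning
... | no y≮m = begin
  map h (filter (isLRMinBelow? m (y ∷ ys)) (allFin (suc (length ys))))
    ≡⟨ map-filter-allFin-reject (isLRMinBelow? m (y ∷ ys)) (isLRMinBelow? m ys) (λ p → isLRMinBelow-suc-≮ ys p y≮m) h (y≮m ∘ proj₁) ⟩
  map (h ∘ F.suc) (filter (isLRMinBelow? m ys) (allFin (length ys)))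
    ≡⟨ trans (map-cong (shift-position {i} {y} ys) _) (minima-spec (suc i) m ys) ⟩
  minima (suc i) m ys ∎
  where
  h : Fin (length (y ∷ ys)) → ℕ × ℕ
  h p = (i + toℕ p , lookup (y ∷ ys) p)
  open ≡.≡-Reasoning

nonMinima-spec : ∀ m xs → map (lookup xs) (filter (¬? ∘ isLRMinBelow? m xs) (allFin (length xs))) ≡ nonMinima m xs
nonMinima-spec m [] = refl
nonMinima-spec m (y ∷ ys) with y <? m
... | yes y<m = trans
  (map-filter-allFin-reject (¬? ∘ isLRMinBelow? m (y ∷ ys)) (¬? ∘ isLRMinBelow? y ys) (λ p → ¬-cong-⇔ (isLRMinBelow-suc-< ys p y<m)) (lookup (y ∷ ys))
    (λ ¬below → ¬below (y<m , isLRMin-zero y ys)))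
  (nonMinima-spec y ys)
... | no y≮m = trans
  (map-filter-allFin-accept (¬? ∘ isLRMinBelow? m (y ∷ ys)) (¬? ∘ isLRMinBelow? m ys) (λ p → ¬-cong-⇔ (isLRMinBelow-suc-≮ ys p y≮m)) (lookup (y ∷ ys))
    (y≮m ∘ proj₁))
  (cong (y ∷_) (nonMinima-spec m ys))

M≡minima₀ : ∀ σ → M σ ≡ minima₀ σ
M≡minima₀ [] = refl
M≡minima₀ (x ∷ xs) = trans
  (map-filter-allFin-accept (isLRMin? (x ∷ xs)) (isLRMinBelow? x xs) (isLRMin-suc x xs) (λ p → (suc (toℕ p) , lookup (x ∷ xs) p))
    (isLRMin-zero x xs))
  (cong ((1 , x) ∷_) (minima-spec 2 x xs))

∖M≡nonMinima₀ : ∀ σ → σ ∖M ≡ nonMinima₀ σ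
∖M≡nonMinima₀ [] = refl
∖M≡nonMinima₀ (x ∷ xs) = trans
  (map-filter-allFin-reject (¬? ∘ isLRMin? (x ∷ xs)) (¬? ∘ isLRMinBelow? x xs) (¬-cong-⇔ ∘ isLRMin-suc x xs) (lookup (x ∷ xs))
    (λ ¬min → ¬min (isLRMin-zero x xs)))
  (nonMinima-spec x xs)

M-positionsIncreasing : ∀ σ → PositionsIncreasing (M σ)
M-positionsIncreasing σ = subst PositionsIncreasing (sym (M≡minima₀ σ)) (minima₀-positionsIncreasing σ)

IsPerm⇒Unique : ∀ {N σ} → IsPerm N σ → Unique σ
IsPerm⇒Unique {N} σ↭ = Unique-resp-↭ (↭⇒↭ₛ (↭-sym σ↭)) (map⁺-Unique suc-injective (upTo⁺ N))

lemma2p1 :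
    ((N : ℕ) (σ σ′ : List ℕ) → IsPerm N σ → IsPerm N σ′
      → (∀ x → (x ∈ M σ) ⇔ (x ∈ M σ′))
      → Patt (σ ∖M) ≡ Patt (σ′ ∖M)
      → σ ≡ σ′)
    ×
    ((N k : ℕ) (σ τ̂ : List ℕ) → IsPerm N σ → IsPerm k τ̂ → head τ̂ ≡ just 1
      → Avoids σ (1⊘ τ̂) ⇔ Avoids (Patt (σ ∖M)) τ̂)
lemma2p1 = determined , avoidance
  where
  determined : (N : ℕ) (σ σ′ : List ℕ) → IsPerm N σ → IsPerm N σ′
    → (∀ x → (x ∈ M σ) ⇔ (x ∈ M σ′)) → Patt (σ ∖M) ≡ Patt (σ′ ∖M) → σ ≡ σ′
  determined N σ σ′ σ↭ σ′↭ sameM samePatt = determined-by-minima₀ (↭-trans σ↭ (↭-sym σ′↭)) sameMinima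
    (subst₂ (λ ρ ρ′ → Patt ρ ≡ Patt ρ′) (∖M≡nonMinima₀ σ) (∖M≡nonMinima₀ σ′) samePatt)
    where
    sameMinima : minima₀ σ ≡ minima₀ σ′
    sameMinima = begin
      minima₀ σ   ≡⟨ M≡minima₀ σ ⟨
      M σ         ≡⟨ sorted-sameMembers⇒≡ <-asym (M-positionsIncreasing σ) (M-positionsIncreasing σ′) sameM ⟩
      M σ′        ≡⟨ M≡minima₀ σ′ ⟩
      minima₀ σ′  ∎
      where open ≡.≡-Reasoning

  avoidance : (N k : ℕ) (σ τ̂ : List ℕ) → IsPerm N σ → IsPerm k τ̂ → head τ̂ ≡ just 1
    → Avoids σ (1⊘ τ̂) ⇔ Avoids (Patt (σ ∖M)) τ̂
  avoidance N k σ (1 ∷ t) σ↭ _ refl rewrite ∖M≡nonMinima₀ σ = ¬-cong-⇔ (⇔.trans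
    (Contains-1⊘⇔Contains-nonMinima₀ σ t (IsPerm⇒Unique σ↭))
    (⇔.sym (Contains-Patt (nonMinima₀ σ) (1 ∷ t))))
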